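{- Let $n\ge 1$ and $\lceil (n+1)/2\rceil\le k\le n$ be integers. The number of partitions $\pi$ into distinct parts with largest part $\pi_1=k$ and $\Gamma(\pi)=n$ equals the number of partitions $\lambda$ into odd parts with $\lambda_1/2+\ell(\lambda)=k+1/2$ and $\Gamma(\lambda)=n$. Both numbers equal $\binom{k-1}{n-k}$.
   Context: For a non-empty partition $\pi=(\pi_1\ge\cdots\ge\pi_r\ge1)$, $\ell(\pi)=r$ and $\Gamma(\pi)=\pi_1+\ell(\pi)-1$ (length of the largest hook). -}

module Defs where

open import Data.Nat using (ℕ; zero; suc; _+_; _*_; _∸_; _≤_; _<_; _≥_; _>_; _%_)
open import Data.List using (List; []; _∷_; length)
open import Data.List.Relation.Unary.All using (All)
open import Data.List.Relation.Unary.Linked using (Linked)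
open import Data.List.Relation.Unary.Unique.Propositional using (Unique)
open import Data.List.Membership.Propositional using (_∈_)
open import Data.Product using (Σ; _×_)
open import Function.Bundles using (_⇔_)
open import Relation.Binary.PropositionalEquality using (_≡_)

-- A partition is represented by the list of its parts (π₁, π₂, …, π_r),
-- weakly decreasing, all parts ≥ 1. Non-empty partitions have r ≥ 1.
data NonEmpty : List ℕ → Set where
  nonEmpty : ∀ {x xs} → NonEmpty (x ∷ xs)

IsPartition : List ℕ → Set
IsPartition π = NonEmpty π × All (λ p → 1 ≤ p) π × Linked _≥_ π

DistinctParts : List ℕ → Set
DistinctParts π = Linked _>_ π

IsOdd : ℕ → Set
IsOdd m = m % 2 ≡ 1

OddParts : List ℕ → Set
OddParts π = All IsOdd π

-- largest part π₁ (0 for the empty list; only used on non-empty partitions)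
largest : List ℕ → ℕ
largest [] = 0
largest (x ∷ _) = x

len : List ℕ → ℕ
len = length

Γ : List ℕ → ℕ
Γ π = largest π + len π ∸ 1

HasCount : (List ℕ → Set) → ℕ → Set
HasCount P m = Σ (List (List ℕ)) λ L → Unique L × (∀ π → (π ∈ L) ⇔ P π) × length L ≡ m

-- Removing the largest part k from a partition into distinct parts with Γ = n leaves
-- n − k distinct parts below k, i.e. an (n − k)-subset of {1, …, k − 1}: there are
-- C(k − 1, n − k) of them. For a partition into odd parts, the conditions
-- λ₁ + 2ℓ = 2k + 1 and λ₁ + ℓ − 1 = n force λ₁ = 2(n − k) + 1 and ℓ = 2k − n, so the
-- remaining parts form a multiset of size 2k − n − 1 drawn from the n − k + 1 odd numbers
-- ≤ λ₁, of which there are C(k − 1, n − k) as well. Both counts are obtained by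
-- enumerating the tails along Pascal's rule.
module Submission where

open import Defs
open import Data.Nat using (ℕ; zero; suc; _+_; _*_; _∸_; _≤_; _<_; _≥_; z≤n; s≤s; s≤s⁻¹; _/_; _%_; ⌊_/2⌋; ⌈_/2⌉)
open import Data.Nat.Properties
open import Data.Nat.DivMod using (m≡m%n+[m/n]*n; [m+kn]%n≡m%n)
open import Data.Nat.Combinatorics using (_C_; nCk+nC[k+1]≡[n+1]C[k+1]; nCn≡1)
open import Data.Nat.Tactic.RingSolver using (solve-∀)
open import Data.List using (List; []; _∷_; map; _++_; length)
open import Data.List.Properties using (length-++; length-map; ∷-injectiveʳ)
open import Data.List.Relation.Unary.All as All using (All; []; _∷_)
open import Data.List.Relation.Unary.Linked as Linked using (Linked; [-]; _∷_)
import Data.List.Relation.Unary.Unique.Propositional.Properties as Unique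
open import Data.List.Relation.Unary.AllPairs using ([]; _∷_)
open import Data.List.Membership.Propositional using (_∈_)
open import Data.List.Membership.Propositional.Properties using (∈-map⁺; ∈-map⁻; ∈-++⁺ˡ; ∈-++⁺ʳ; ∈-++⁻)
open import Data.List.Relation.Unary.Any using (here; there)
open import Data.Product using (Σ; _×_; _,_)
open import Data.Sum using (_⊎_; inj₁; inj₂; [_,_])
open import Data.Empty using (⊥; ⊥-elim)
open import Function using (_∘_)
open import Function.Bundles using (_⇔_; mk⇔; module Equivalence)
open import Function.Construct.Symmetry using (⇔-sym)
open import Function.Construct.Composition using (_⇔-∘_)
open import Relation.Binary.PropositionalEquality using (_≡_; refl; sym; trans; cong; cong₂; subst; module ≡-Reasoning)
open import Relation.Nullary using (¬_)

open Equivalence using (to; from)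

module _ {P Q : List ℕ → Set} where

  HasCount-⇔ : ∀ {m} → (∀ π → P π ⇔ Q π) → HasCount P m → HasCount Q m
  HasCount-⇔ P⇔Q (L , unique , ∈L⇔P , |L|≡m) = L , unique , (λ π → P⇔Q π ⇔-∘ ∈L⇔P π) , |L|≡m

  HasCount-⊎ : ∀ {a b} → (∀ π → P π → ¬ Q π) →
               HasCount P a → HasCount Q b → HasCount (λ π → P π ⊎ Q π) (a + b)
  HasCount-⊎ disjoint (L , uL , ∈L⇔P , |L|≡a) (M , uM , ∈M⇔Q , |M|≡b) =
    L ++ M ,
    Unique.++⁺ uL uM (λ (π∈L , π∈M) → disjoint _ (to (∈L⇔P _) π∈L) (to (∈M⇔Q _) π∈M)) ,
    (λ π → mk⇔ (λ π∈ → [ inj₁ ∘ to (∈L⇔P π) , inj₂ ∘ to (∈M⇔Q π) ] (∈-++⁻ L π∈))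
               [ ∈-++⁺ˡ ∘ from (∈L⇔P π) , ∈-++⁺ʳ L ∘ from (∈M⇔Q π) ]) ,
    trans (length-++ L) (cong₂ _+_ |L|≡a |M|≡b)

HasCount-empty : ∀ {P : List ℕ → Set} → (∀ π → ¬ P π) → HasCount P 0
HasCount-empty ¬P = [] , [] , (λ π → mk⇔ (λ ()) (λ p → ⊥-elim (¬P π p))) , refl

HasCount-[] : HasCount (_≡ []) 1
HasCount-[] = [] ∷ [] , [] ∷ [] , (λ π → mk⇔ (λ { (here π≡[]) → π≡[] ; (there ()) }) (here)) , refl

Cons : ℕ → (List ℕ → Set) → List ℕ → Set
Cons x Q []       = ⊥
Cons x Q (y ∷ ys) = y ≡ x × Q ys

HasCount-Cons : ∀ {Q : List ℕ → Set} {m} x → HasCount Q m → HasCount (Cons x Q) m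
HasCount-Cons {Q} x (L , unique , ∈L⇔Q , |L|≡m) =
  map (x ∷_) L , Unique.map⁺ ∷-injectiveʳ unique , (λ π → mk⇔ (sound π) (complete π)) ,
  trans (length-map (x ∷_) L) |L|≡m
  where
  sound : ∀ π → π ∈ map (x ∷_) L → Cons x Q π
  sound π π∈ with ∈-map⁻ (x ∷_) π∈
  ... | ys , ys∈L , refl = refl , to (∈L⇔Q ys) ys∈L
  complete : ∀ π → Cons x Q π → π ∈ map (x ∷_) L
  complete (.x ∷ ys) (refl , q) = ∈-map⁺ (x ∷_) (from (∈L⇔Q ys) q)

Linked-weakenHead : ∀ {R : ℕ → ℕ → Set} {a b xs} → (∀ {c} → R a c → R b c) →
                    Linked R (a ∷ xs) → Linked R (b ∷ xs)
Linked-weakenHead weaken [-]       = [-]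
Linked-weakenHead weaken (r ∷ rs) = weaken r ∷ rs

Γ-∷ : ∀ x xs → Γ (x ∷ xs) ≡ x + length xs
Γ-∷ x xs = cong (_∸ 1) (+-suc x (length xs))

StrictTail : ℕ → ℕ → List ℕ → Set
StrictTail b j xs = All (1 ≤_) xs × DistinctParts (suc b ∷ xs) × length xs ≡ j

strictTail-zero : ∀ {b} π → StrictTail b 0 π ⇔ π ≡ []
strictTail-zero []       = mk⇔ (λ _ → refl) (λ _ → [] , [-] , refl)
strictTail-zero (x ∷ xs) = mk⇔ (λ { (_ , _ , ()) }) (λ ())

strictTail-bottom : ∀ {j} π → ¬ StrictTail 0 (suc j) π
strictTail-bottom (x ∷ xs) ((s≤s z≤n ∷ _) , (s≤s () ∷ _) , _)

strictTail-suc : ∀ {b j} π →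
  StrictTail (suc b) (suc j) π ⇔ (Cons (suc b) (StrictTail b j) π ⊎ StrictTail b (suc j) π)
strictTail-suc [] = mk⇔ (λ { (_ , _ , ()) }) (λ { (inj₂ (_ , _ , ())) })
strictTail-suc {b} {j} (x ∷ xs) = mk⇔ split join
  where
  split : StrictTail (suc b) (suc j) (x ∷ xs) → _
  split ((1≤x ∷ pos) , (s≤s x≤1+b ∷ dec) , |xs|≡j) with m≤n⇒m<n∨m≡n x≤1+b
  ... | inj₂ refl = inj₁ (refl , pos , dec , suc-injective |xs|≡j)
  ... | inj₁ x<1+b = inj₂ ((1≤x ∷ pos) , (x<1+b ∷ dec) , |xs|≡j)
  join : _ → StrictTail (suc b) (suc j) (x ∷ xs)
  join (inj₁ (refl , pos , dec , |xs|≡j)) = (s≤s z≤n ∷ pos) , (n<1+n x ∷ dec) , cong suc |xs|≡j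
  join (inj₂ (pos , dec , |π|≡j)) = pos , Linked-weakenHead m<n⇒m<1+n dec , |π|≡j

strictTail-disjoint : ∀ {b j} π → Cons (suc b) (StrictTail b j) π → ¬ StrictTail b (suc j) π
strictTail-disjoint (x ∷ xs) (refl , _) (_ , (b<b ∷ _) , _) = n≮n _ b<b

strictTails : ∀ b j → HasCount (StrictTail b j) (b C j)
strictTails b       zero    = HasCount-⇔ (⇔-sym ∘ strictTail-zero) HasCount-[]
strictTails zero    (suc j) = HasCount-empty strictTail-bottom
strictTails (suc b) (suc j) =
  subst (HasCount (StrictTail (suc b) (suc j))) (nCk+nC[k+1]≡[n+1]C[k+1] b j)
    (HasCount-⇔ (⇔-sym ∘ strictTail-suc)
      (HasCount-⊎ strictTail-disjoint (HasCount-Cons (suc b) (strictTails b j)) (strictTails b (suc j))))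

distinct⇔Cons : ∀ K r π →
  (IsPartition π × DistinctParts π × largest π ≡ suc K × Γ π ≡ suc K + r) ⇔ Cons (suc K) (StrictTail K r) π
distinct⇔Cons K r [] = mk⇔ (λ { ((() , _) , _) }) (λ ())
distinct⇔Cons K r (x ∷ xs) = mk⇔ to′ from′
  where
  to′ : _ → Cons (suc K) (StrictTail K r) (x ∷ xs)
  to′ ((_ , (_ ∷ pos) , _) , dec , refl , Γ≡) =
    refl , pos , dec , +-cancelˡ-≡ (suc K) _ _ (trans (sym (Γ-∷ x xs)) Γ≡)
  from′ : Cons (suc K) (StrictTail K r) (x ∷ xs) → _
  from′ (refl , pos , dec , refl) =
    (nonEmpty , (s≤s z≤n ∷ pos) , Linked.map <⇒≤ dec) , dec , refl , Γ-∷ x xs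

distinctPartitions : ∀ K r →
  HasCount (λ π → IsPartition π × DistinctParts π × largest π ≡ suc K × Γ π ≡ suc K + r) (K C r)
distinctPartitions K r = HasCount-⇔ (⇔-sym ∘ distinct⇔Cons K r) (HasCount-Cons (suc K) (strictTails K r))

odd⇒≡1+2*half : ∀ {x} → IsOdd x → x ≡ suc (2 * (x / 2))
odd⇒≡1+2*half {x} odd = trans (m≡m%n+[m/n]*n x 2) (cong₂ _+_ odd (*-comm (x / 2) 2))

1+2*-odd : ∀ u → IsOdd (suc (2 * u))
1+2*-odd u = trans (cong (λ t → suc t % 2) (*-comm 2 u)) ([m+kn]%n≡m%n 1 u 2)

odd⇒1≤ : ∀ {x} → IsOdd x → 1 ≤ x
odd⇒1≤ {suc x} _ = s≤s z≤n

odd≤1+2*⇒half≤ : ∀ {x v} → IsOdd x → x ≤ suc (2 * v) → Σ ℕ λ u → x ≡ suc (2 * u) × u ≤ v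
odd≤1+2*⇒half≤ {x} odd x≤ =
  x / 2 , x≡ , *-cancelˡ-≤ 2 (s≤s⁻¹ (subst (_≤ _) x≡ x≤))
  where
  x≡ : x ≡ suc (2 * (x / 2))
  x≡ = odd⇒≡1+2*half odd

OddTail : ℕ → ℕ → List ℕ → Set
OddTail v j xs = OddParts xs × Linked _≥_ (suc (2 * v) ∷ xs) × length xs ≡ j

oddTail-zero : ∀ {v} π → OddTail v 0 π ⇔ π ≡ []
oddTail-zero []       = mk⇔ (λ _ → refl) (λ _ → [] , [-] , refl)
oddTail-zero (x ∷ xs) = mk⇔ (λ { (_ , _ , ()) }) (λ ())

oddTail-bottom : ∀ {j} π → OddTail 0 (suc j) π ⇔ Cons 1 (OddTail 0 j) π
oddTail-bottom [] = mk⇔ (λ { (_ , _ , ()) }) (λ ())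
oddTail-bottom {j} (x ∷ xs) = mk⇔ to′ from′
  where
  to′ : OddTail 0 (suc j) (x ∷ xs) → Cons 1 (OddTail 0 j) (x ∷ xs)
  to′ ((odd ∷ odds) , (x≤1 ∷ dec) , |xs|≡j) with odd≤1+2*⇒half≤ {v = 0} odd x≤1
  ... | _ , refl , z≤n = refl , odds , dec , suc-injective |xs|≡j
  from′ : Cons 1 (OddTail 0 j) (x ∷ xs) → OddTail 0 (suc j) (x ∷ xs)
  from′ (refl , odds , dec , |xs|≡j) = (refl ∷ odds) , (≤-refl ∷ dec) , cong suc |xs|≡j

oddTail-suc : ∀ {v j} π →
  OddTail (suc v) (suc j) π ⇔ (Cons (suc (2 * suc v)) (OddTail (suc v) j) π ⊎ OddTail v (suc j) π)
oddTail-suc [] = mk⇔ (λ { (_ , _ , ()) }) (λ { (inj₂ (_ , _ , ())) })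
oddTail-suc {v} {j} (x ∷ xs) = mk⇔ split join
  where
  split : OddTail (suc v) (suc j) (x ∷ xs) → _
  split ((odd ∷ odds) , (x≤ ∷ dec) , |xs|≡j) with odd≤1+2*⇒half≤ {v = suc v} odd x≤
  ... | u , refl , u≤1+v with m≤n⇒m<n∨m≡n u≤1+v
  ...   | inj₂ refl      = inj₁ (refl , odds , dec , suc-injective |xs|≡j)
  ...   | inj₁ (s≤s u≤v) = inj₂ ((odd ∷ odds) , (s≤s (*-monoʳ-≤ 2 u≤v) ∷ dec) , |xs|≡j)
  join : _ → OddTail (suc v) (suc j) (x ∷ xs)
  join (inj₁ (refl , odds , dec , |xs|≡j)) = (1+2*-odd (suc v) ∷ odds) , (≤-refl ∷ dec) , cong suc |xs|≡j
  join (inj₂ (odds , dec , |π|≡j)) =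
    odds , Linked-weakenHead (λ c≤ → ≤-trans c≤ (s≤s (*-monoʳ-≤ 2 (n≤1+n v)))) dec , |π|≡j

oddTail-disjoint : ∀ {v j} π → Cons (suc (2 * suc v)) (OddTail (suc v) j) π → ¬ OddTail v (suc j) π
oddTail-disjoint (x ∷ xs) (refl , _) (_ , (x≤ ∷ _) , _) = 1+n≰n (*-cancelˡ-≤ 2 (s≤s⁻¹ x≤))

-- (v + j) C v counts the multisets of size j drawn from v + 1 elements.
multiset-pascal : ∀ v j → (suc v + j) C suc v + (v + suc j) C v ≡ (suc v + suc j) C suc v
multiset-pascal v j = begin
  suc (v + j) C suc v + (v + suc j) C v     ≡⟨ cong (λ t → suc (v + j) C suc v + t C v) (+-suc v j) ⟩
  suc (v + j) C suc v + suc (v + j) C v     ≡⟨ +-comm (suc (v + j) C suc v) _ ⟩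
  suc (v + j) C v + suc (v + j) C suc v     ≡⟨ nCk+nC[k+1]≡[n+1]C[k+1] (suc (v + j)) v ⟩
  suc (suc (v + j)) C suc v                 ≡⟨ cong (λ t → suc t C suc v) (+-suc v j) ⟨
  suc (v + suc j) C suc v                   ∎
  where open ≡-Reasoning

oddTails : ∀ v j → HasCount (OddTail v j) ((v + j) C v)
oddTails v       zero    =
  subst (HasCount (OddTail v 0)) (sym (trans (cong (_C v) (+-identityʳ v)) (nCn≡1 v)))
    (HasCount-⇔ (⇔-sym ∘ oddTail-zero {v}) HasCount-[])
oddTails zero    (suc j) = HasCount-⇔ (⇔-sym ∘ oddTail-bottom) (HasCount-Cons 1 (oddTails zero j))
oddTails (suc v) (suc j) =
  subst (HasCount (OddTail (suc v) (suc j))) (multiset-pascal v j)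
    (HasCount-⇔ (⇔-sym ∘ oddTail-suc)
      (HasCount-⊎ oddTail-disjoint (HasCount-Cons (suc (2 * suc v)) (oddTails (suc v) j)) (oddTails v (suc j))))

hookConditions : ∀ {a l} m j →
  (a + 2 * suc l ≡ 2 * suc (m + j) + 1 × a + l ≡ suc (m + j) + m) ⇔ (a ≡ suc (2 * m) × l ≡ j)
hookConditions {a} {l} m j = mk⇔ solve (λ { (refl , refl) → identity₁ m j , identity₂ m j })
  where
  open ≡-Reasoning
  identity₁ : ∀ m j → suc (2 * m) + 2 * suc j ≡ 2 * suc (m + j) + 1
  identity₁ = solve-∀
  identity₂ : ∀ m j → suc (2 * m) + j ≡ suc (m + j) + m
  identity₂ = solve-∀
  identity₃ : ∀ a l → a + l + suc (suc l) ≡ a + 2 * suc l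
  identity₃ = solve-∀
  identity₄ : ∀ m j → 2 * suc (m + j) + 1 ≡ suc (m + j) + m + suc (suc j)
  identity₄ = solve-∀
  solve : _ → a ≡ suc (2 * m) × l ≡ j
  solve (e₁ , e₂) = +-cancelʳ-≡ j a (suc (2 * m)) a+j≡ , l≡j
    where
    l≡j : l ≡ j
    l≡j = suc-injective (suc-injective (+-cancelˡ-≡ (suc (m + j) + m) _ _ (begin
      suc (m + j) + m + suc (suc l)   ≡⟨ cong (_+ suc (suc l)) e₂ ⟨
      a + l + suc (suc l)             ≡⟨ identity₃ a l ⟩
      a + 2 * suc l                   ≡⟨ e₁ ⟩
      2 * suc (m + j) + 1             ≡⟨ identity₄ m j ⟩
      suc (m + j) + m + suc (suc j)   ∎)))
    a+j≡ : a + j ≡ suc (2 * m) + j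
    a+j≡ = begin
      a + j                 ≡⟨ cong (a +_) l≡j ⟨
      a + l                 ≡⟨ e₂ ⟩
      suc (m + j) + m       ≡⟨ identity₂ m j ⟨
      suc (2 * m) + j       ∎

odd⇔Cons : ∀ m j π →
  (IsPartition π × OddParts π × largest π + 2 * len π ≡ 2 * suc (m + j) + 1 × Γ π ≡ suc (m + j) + m)
    ⇔ Cons (suc (2 * m)) (OddTail m j) π
odd⇔Cons m j [] = mk⇔ (λ { ((() , _) , _) }) (λ ())
odd⇔Cons m j (x ∷ xs) = mk⇔ to′ from′
  where
  to′ : _ → Cons (suc (2 * m)) (OddTail m j) (x ∷ xs)
  to′ ((_ , _ , dec) , (_ ∷ odds) , e₁ , e₂) with to (hookConditions m j) (e₁ , trans (sym (Γ-∷ x xs)) e₂)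
  ... | refl , |xs|≡j = refl , odds , dec , |xs|≡j
  from′ : Cons (suc (2 * m)) (OddTail m j) (x ∷ xs) → _
  from′ (refl , odds , dec , |xs|≡j) with from (hookConditions m j) (refl , |xs|≡j)
  ... | e₁ , e₂ = (nonEmpty , All.map odd⇒1≤ allOdd , dec) , allOdd , e₁ , trans (Γ-∷ x xs) e₂
    where
    allOdd : OddParts (x ∷ xs)
    allOdd = 1+2*-odd m ∷ odds

oddPartitions : ∀ m j →
  HasCount (λ π → IsPartition π × OddParts π × largest π + 2 * len π ≡ 2 * suc (m + j) + 1
                  × Γ π ≡ suc (m + j) + m) ((m + j) C m)
oddPartitions m j = HasCount-⇔ (⇔-sym ∘ odd⇔Cons m j) (HasCount-Cons (suc (2 * m)) (oddTails m j))

n<k+k : ∀ {n k} → ⌈ n + 1 /2⌉ ≤ k → n < k + k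
n<k+k {n} {k} ⌈n+1/2⌉≤k = begin-strict
  n                                 <⟨ n<1+n n ⟩
  suc n                             ≡⟨ +-comm 1 n ⟩
  n + 1                             ≡⟨ ⌊n/2⌋+⌈n/2⌉≡n (n + 1) ⟨
  ⌊ n + 1 /2⌋ + ⌈ n + 1 /2⌉         ≤⟨ +-monoˡ-≤ _ (⌊n/2⌋≤⌈n/2⌉ (n + 1)) ⟩
  ⌈ n + 1 /2⌉ + ⌈ n + 1 /2⌉         ≤⟨ +-mono-≤ ⌈n+1/2⌉≤k ⌈n+1/2⌉≤k ⟩
  k + k                             ∎
  where open ≤-Reasoning

hookRange-parametrisation : ∀ {n k} → ⌈ n + 1 /2⌉ ≤ k → k ≤ n →
  Σ ℕ λ m → Σ ℕ λ j → k ≡ suc (m + j) × n ≡ suc (m + j) + m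
hookRange-parametrisation {n} {k} ⌈n+1/2⌉≤k k≤n =
  m , k ∸ suc m , k≡ , trans n≡k+m (cong (_+ m) k≡)
  where
  m : ℕ
  m = n ∸ k
  n≡k+m : n ≡ k + m
  n≡k+m = sym (m+[n∸m]≡n k≤n)
  m<k : m < k
  m<k = +-cancelˡ-< k m k (subst (_< k + k) n≡k+m (n<k+k ⌈n+1/2⌉≤k))
  k≡ : k ≡ suc (m + (k ∸ suc m))
  k≡ = sym (m+[n∸m]≡n m<k)

theorem2p9 : (n k : ℕ) → 1 ≤ n → ⌈ n + 1 /2⌉ ≤ k → k ≤ n →
    HasCount (λ π → IsPartition π × DistinctParts π × largest π ≡ k × Γ π ≡ n) ((k ∸ 1) C (n ∸ k))
    × HasCount (λ λ' → IsPartition λ' × OddParts λ' × largest λ' + 2 * len λ' ≡ 2 * k + 1 × Γ λ' ≡ n) ((k ∸ 1) C (n ∸ k))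
-- The hypothesis 1 ≤ n is implied by the other two.
theorem2p9 n k _ ⌈n+1/2⌉≤k k≤n with hookRange-parametrisation ⌈n+1/2⌉≤k k≤n
... | m , j , refl , refl rewrite m+n∸m≡n (suc (m + j)) m = distinctPartitions (m + j) m , oddPartitions m j
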